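{- Let $n\ge4$. The number of topdrop-valid necklaces in $S_n$ of the form $[a,b,c,n,c,b,a,n]$ or $[a,b,c,n-1,c,b,a,n-1]$ with $a,b,c$ pairwise distinct natural numbers, $1\le a,b,c\le n-2$ and $a+b+c=n-1$, is at least: $\tfrac12n^2-4n+6$ if $n\equiv0$ or $2\pmod 6$; $\tfrac12n^2-4n+\tfrac{19}{2}$ if $n\equiv1\pmod 6$; $\tfrac12n^2-4n+\tfrac{15}{2}$ if $n\equiv3$ or $5\pmod 6$; $\tfrac12n^2-4n+8$ if $n\equiv4\pmod 6$.
   Context: Permutations are in one-line notation $\pi=\pi_1\cdots\pi_n$. The topdrop map $T:S_n\to S_n$ is $T(\pi_1\cdots\pi_n)=\pi_{\pi_1+1}\cdots\pi_n\,\pi_{\pi_1}\pi_{\pi_1-1}\cdots\pi_1$ (first $\pi_1$ entries removed, reversed, appended at the end); it is a bijection. The topdrop-necklace of $\pi$ is the cyclic sequence $[\pi_1,T(\pi)_1,\dots,T^{s-1}(\pi)_1]$, where $s\ge1$ is minimal with $T^s(\pi)=\pi$, considered up to cyclic rotation (necklaces are counted as cyclic sequences up to rotation). A necklace is topdrop-valid in $S_n$ if it is the topdrop-necklace of some $\pi\in S_n$. -}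

module Defs where

open import Data.Nat using (ℕ; zero; suc; _+_; _*_; _∸_; _≤_; _<_; _%_)
open import Data.List using (List; []; _∷_; _++_; drop; take; reverse; map; upTo; length)
open import Data.List.Relation.Binary.Permutation.Propositional using (_↭_)
open import Data.List.Relation.Unary.All using (All)
open import Data.List.Relation.Unary.AllPairs using (AllPairs)
open import Data.Product using (Σ; ∃; _×_; _,_)
open import Data.Sum using (_⊎_)
open import Relation.Binary.PropositionalEquality using (_≡_; _≢_)
open import Relation.Nullary using (¬_)

IsPerm : ℕ → List ℕ → Set
IsPerm n π = π ↭ map suc (upTo n)

topdrop : List ℕ → List ℕ
topdrop [] = []
topdrop (x ∷ xs) = drop x (x ∷ xs) ++ reverse (take x (x ∷ xs))

iter : ℕ → List ℕ → List ℕ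
iter zero π = π
iter (suc k) π = iter k (topdrop π)

-- first entry (never used on the empty list for n ≥ 1)
first : List ℕ → ℕ
first [] = 0
first (x ∷ _) = x

heads : ℕ → List ℕ → List ℕ
heads zero π = []
heads (suc k) π = first π ∷ heads k (topdrop π)

MinPeriod : List ℕ → ℕ → Set
MinPeriod π s = (1 ≤ s) × (iter s π ≡ π) × (∀ j → 1 ≤ j → j < s → iter j π ≢ π)

rotate : ℕ → List ℕ → List ℕ
rotate k w = drop k w ++ take k w

_≈ᶜ_ : List ℕ → List ℕ → Set
u ≈ᶜ v = ∃ λ k → rotate k u ≡ v

IsTopdropNecklaceOf : List ℕ → List ℕ → Set
IsTopdropNecklaceOf w π = ∃ λ s → MinPeriod π s × (heads s π ≈ᶜ w)

TopdropValid : ℕ → List ℕ → Set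
TopdropValid n w = ∃ λ π → IsPerm n π × IsTopdropNecklaceOf w π

OfForm : ℕ → List ℕ → Set
OfForm n w = Σ ℕ λ a → Σ ℕ λ b → Σ ℕ λ c → Σ ℕ λ m →
  (a ≢ b) × (b ≢ c) × (a ≢ c) ×
  (1 ≤ a) × (a ≤ n ∸ 2) × (1 ≤ b) × (b ≤ n ∸ 2) × (1 ≤ c) × (c ≤ n ∸ 2) ×
  (a + b + c ≡ n ∸ 1) × ((m ≡ n) ⊎ (m ≡ n ∸ 1)) ×
  (w ≡ a ∷ b ∷ c ∷ m ∷ c ∷ b ∷ a ∷ m ∷ [])

-- twice the constant term of the bound, by residue of n mod 6:
-- 0,2 ↦ 12 ; 1 ↦ 19 ; 3,5 ↦ 15 ; 4 ↦ 16
constBy : ℕ → ℕ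
constBy 0 = 12
constBy 1 = 19
constBy 2 = 12
constBy 3 = 15
constBy 4 = 16
constBy _ = 15

-- "count ≥ n²/2 − 4n + C/2"  ⇔  n² + C ≤ 2·count + 8n
MeetsBound : ℕ → ℕ → Set
MeetsBound n count = n * n + constBy (n % 6) ≤ 2 * count + 8 * n

{-# OPTIONS --safe #-}
module Submission where

-- For a + b + c = N and m ∈ {N, N + 1}, the permutation  a X b Y c Z m  of [1 .. N + 1] with
-- |X| = a − 1, |Y| = b − 1, |Z| = c − 1 is taken by four topdrops to  c Z b Y a X m  and by four
-- more back to itself, reading off [a,b,c,m,c,b,a,m].  When a < c and b < m this word is
-- primitive and is not a rotation of any other word of this kind, so distinct tuples give
-- distinct necklaces.
-- Each partition x < y < z of N gives three tuples (b = x, y or z) and two values of m.  For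
-- N = M + 6 these partitions correspond to the partitions of M into parts ≤ 3 (with x − 1 threes,
-- y − x − 1 twos and z − y − 1 ones), whose number c(M) satisfies c(M + 6) = c(M) + M + 6; this
-- is exactly the growth that carries the bound from n to n + 6.

open import Defs
open import Data.Nat using (ℕ; zero; suc; _+_; _*_; _∸_; _%_; _≤_; _<_; s≤s; z≤n)
open import Data.Nat.Properties
  using ( suc-injective; +-comm; +-assoc; +-suc; +-cancelˡ-≡; *-distribˡ-+; 1+n≢n
        ; ≤-refl; ≤-trans; ≤-reflexive; <-≤-trans; <-trans; <-irrefl; <-asym; <⇒≤; <⇒≢; <⇒≱; <⇒≤pred
        ; n≤1+n; m≤m+n; m<m+n; m<n+m; m+[n∸m]≡n; +-monoˡ-≤; ≤ᵇ⇒≤; module ≤-Reasoning )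
open import Data.Nat.DivMod using ([m+n]%n≡m%n)
open import Data.Nat.Tactic.RingSolver using (solve-∀)
open import Data.List using (List; []; _∷_; _++_; [_]; drop; take; reverse; length; map; upTo)
open import Data.List.Properties
  using (++-assoc; ++-identityʳ; reverse-++; reverse-involutive; length-reverse; unfold-reverse; length-++; length-map; length-upTo)
open import Data.List.Membership.Propositional using (_∈_)
open import Data.List.Membership.Propositional.Properties using (∈-∃++; ∈-map⁺; ∈-map⁻; ∈-upTo⁺)
open import Data.List.Relation.Unary.Any using (here; there)
open import Data.List.Relation.Unary.All as All using (All; []; _∷_)
import Data.List.Relation.Unary.All.Properties as All
open import Data.List.Relation.Unary.AllPairs using (AllPairs; []; _∷_)
import Data.List.Relation.Unary.AllPairs.Properties as AllPairs
open import Data.List.Relation.Unary.Unique.Propositional using (Unique)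
import Data.List.Relation.Unary.Unique.Propositional.Properties as Unique
open import Data.List.Relation.Binary.Disjoint.Propositional using (Disjoint)
open import Data.List.Relation.Binary.Permutation.Propositional
  using (_↭_; ↭-refl; ↭-sym; ↭-trans; ↭-prep; module PermutationReasoning)
open import Data.List.Relation.Binary.Permutation.Propositional.Properties using (shift; ∈-resp-↭; ++⁺ˡ; ∷↭∷ʳ; ↭-length)
open import Data.Product using (Σ; ∃; ∃₂; _×_; _,_; proj₁; proj₂; map₁)
open import Data.Sum using (_⊎_; inj₁; inj₂)
open import Data.Empty using (⊥-elim)
open import Data.Unit using (tt)
open import Function using (_∘_)
open import Relation.Nullary using (¬_)
open import Relation.Binary.PropositionalEquality
  using (_≡_; _≢_; refl; sym; trans; cong; cong₂; subst; module ≡-Reasoning)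

private variable
  A A′ B : Set

drop-length-++ : ∀ (xs ys : List A) → drop (length xs) (xs ++ ys) ≡ ys
drop-length-++ []       ys = refl
drop-length-++ (x ∷ xs) ys = drop-length-++ xs ys

take-length-++ : ∀ (xs ys : List A) → take (length xs) (xs ++ ys) ≡ xs
take-length-++ []       ys = refl
take-length-++ (x ∷ xs) ys = cong (x ∷_) (take-length-++ xs ys)

rotate-length-++ : ∀ (xs ys : List ℕ) → rotate (length xs) (xs ++ ys) ≡ ys ++ xs
rotate-length-++ xs ys = cong₂ _++_ (drop-length-++ xs ys) (take-length-++ xs ys)

topdrop-prefix : ∀ {k} (X Y : List ℕ) → k ≡ suc (length X) → topdrop (k ∷ X ++ Y) ≡ Y ++ reverse (k ∷ X)
topdrop-prefix {k} X Y refl = cong₂ (λ U V → U ++ reverse (k ∷ V)) (drop-length-++ X Y) (take-length-++ X Y)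

topdrop-reverse : ∀ {m} w V → m ≡ suc (length (w ∷ V)) ⊎ m ≡ length (w ∷ V) →
                  topdrop (m ∷ reverse (w ∷ V)) ≡ (w ∷ V) ++ [ m ]
topdrop-reverse {m} w V (inj₁ m≡2+∣V∣) = begin
  topdrop (m ∷ reverse W)        ≡⟨ cong (λ U → topdrop (m ∷ U)) (++-identityʳ (reverse W)) ⟨
  topdrop (m ∷ reverse W ++ [])  ≡⟨ topdrop-prefix (reverse W) [] (trans m≡2+∣V∣ (cong suc (sym (length-reverse W)))) ⟩
  reverse (m ∷ reverse W)        ≡⟨ unfold-reverse m (reverse W) ⟩
  reverse (reverse W) ++ [ m ]   ≡⟨ cong (_++ [ m ]) (reverse-involutive W) ⟩
  W ++ [ m ]                     ∎
  where
  open ≡-Reasoning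
  W = w ∷ V
topdrop-reverse {m} w V (inj₂ m≡1+∣V∣) = begin
  topdrop (m ∷ reverse (w ∷ V))     ≡⟨ cong (λ U → topdrop (m ∷ U)) (unfold-reverse w V) ⟩
  topdrop (m ∷ reverse V ++ [ w ])  ≡⟨ topdrop-prefix (reverse V) [ w ] (trans m≡1+∣V∣ (cong suc (sym (length-reverse V)))) ⟩
  w ∷ reverse (m ∷ reverse V)       ≡⟨ cong (w ∷_) (unfold-reverse m (reverse V)) ⟩
  w ∷ reverse (reverse V) ++ [ m ]  ≡⟨ cong (λ U → w ∷ U ++ [ m ]) (reverse-involutive V) ⟩
  w ∷ V ++ [ m ]                    ∎
  where open ≡-Reasoning

infixr 5 _∷_
data Path : List ℕ → List ℕ → List ℕ → Set where
  []  : ∀ {π} → Path π [] π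
  _∷_ : ∀ {π π′ ρ w} → topdrop π ≡ π′ → Path π′ w ρ → Path π (first π ∷ w) ρ

_++ᵖ_ : ∀ {π ρ τ u v} → Path π u ρ → Path ρ v τ → Path π (u ++ v) τ
[]      ++ᵖ q = q
(e ∷ p) ++ᵖ q = e ∷ (p ++ᵖ q)

Path-iter : ∀ {π w ρ} → Path π w ρ → iter (length w) π ≡ ρ
Path-iter []                = refl
Path-iter (_∷_ {w = w} e p) = trans (cong (iter (length w)) e) (Path-iter p)

Path-heads : ∀ {π w ρ} → Path π w ρ → heads (length w) π ≡ w
Path-heads []                     = refl
Path-heads (_∷_ {π} {w = w} e p) = cong (first π ∷_) (trans (cong (heads (length w)) e) (Path-heads p))

block : List ℕ → List ℕ
block X = suc (length X) ∷ X

blocks : List ℕ → List ℕ → List ℕ → ℕ → List ℕ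
blocks X Y Z m = block X ++ block Y ++ block Z ++ [ m ]

halfTurn : ∀ X Y Z m → let W = block Z ++ block Y ++ block X in m ≡ suc (length W) ⊎ m ≡ length W →
           Path (blocks X Y Z m) (suc (length X) ∷ suc (length Y) ∷ suc (length Z) ∷ m ∷ []) (blocks Z Y X m)
halfTurn X Y Z m top = step₁ ∷ step₂ ∷ step₃ ∷ step₄ ∷ []
  where
  open ≡-Reasoning
  rX = reverse (block X)
  rY = reverse (block Y)
  rZ = reverse (block Z)
  W = block Z ++ block Y ++ block X
  step₁ : topdrop (blocks X Y Z m) ≡ block Y ++ block Z ++ m ∷ rX
  step₁ = begin
    topdrop (block X ++ block Y ++ block Z ++ [ m ])  ≡⟨ topdrop-prefix X _ refl ⟩
    (block Y ++ block Z ++ [ m ]) ++ rX               ≡⟨ ++-assoc (block Y) _ rX ⟩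
    block Y ++ (block Z ++ [ m ]) ++ rX               ≡⟨ cong (block Y ++_) (++-assoc (block Z) [ m ] rX) ⟩
    block Y ++ block Z ++ m ∷ rX                      ∎
  step₂ : topdrop (block Y ++ block Z ++ m ∷ rX) ≡ block Z ++ m ∷ rX ++ rY
  step₂ = trans (topdrop-prefix Y _ refl) (++-assoc (block Z) (m ∷ rX) rY)
  step₃ : topdrop (block Z ++ m ∷ rX ++ rY) ≡ m ∷ rX ++ rY ++ rZ
  step₃ = trans (topdrop-prefix Z _ refl) (cong (m ∷_) (++-assoc rX rY rZ))
  reverse-W : rX ++ rY ++ rZ ≡ reverse W
  reverse-W = begin
    rX ++ rY ++ rZ                      ≡⟨ ++-assoc rX rY rZ ⟨
    (rX ++ rY) ++ rZ                    ≡⟨ cong (_++ rZ) (reverse-++ (block Y) (block X)) ⟨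
    reverse (block Y ++ block X) ++ rZ  ≡⟨ reverse-++ (block Z) (block Y ++ block X) ⟨
    reverse W                           ∎
  step₄ : topdrop (m ∷ rX ++ rY ++ rZ) ≡ blocks Z Y X m
  step₄ = begin
    topdrop (m ∷ rX ++ rY ++ rZ)              ≡⟨ cong (λ U → topdrop (m ∷ U)) reverse-W ⟩
    topdrop (m ∷ reverse W)                   ≡⟨ topdrop-reverse (suc (length Z)) _ top ⟩
    W ++ [ m ]                                ≡⟨ ++-assoc (block Z) _ [ m ] ⟩
    block Z ++ (block Y ++ block X) ++ [ m ]  ≡⟨ cong (block Z ++_) (++-assoc (block Y) (block X) [ m ]) ⟩
    blocks Z Y X m                            ∎

necklace : (ℕ × ℕ × ℕ) × ℕ → List ℕ
necklace ((a , b , c) , m) = a ∷ b ∷ c ∷ m ∷ c ∷ b ∷ a ∷ m ∷ []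

length-blocks : ∀ X Y Z → length (block X ++ block Y ++ block Z) ≡ suc (length X) + suc (length Y) + suc (length Z)
length-blocks X Y Z = begin
  length (block X ++ block Y ++ block Z)              ≡⟨ length-++ (block X) ⟩
  suc (length X) + length (block Y ++ block Z)        ≡⟨ cong (suc (length X) +_) (length-++ (block Y)) ⟩
  suc (length X) + (suc (length Y) + suc (length Z))  ≡⟨ +-assoc (suc (length X)) _ _ ⟨
  suc (length X) + suc (length Y) + suc (length Z)    ∎
  where open ≡-Reasoning

orbit : ∀ {N m} X Y Z → suc (length X) + suc (length Y) + suc (length Z) ≡ N → m ≡ suc N ⊎ m ≡ N →
        Path (blocks X Y Z m) (necklace ((suc (length X) , suc (length Y) , suc (length Z)) , m)) (blocks X Y Z m)
orbit {N} {m} X Y Z sum top = halfTurn X Y Z m (top-length Z Y X reversed-sum) ++ᵖ halfTurn Z Y X m (top-length X Y Z sum)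
  where
  top-length : ∀ U V W → suc (length U) + suc (length V) + suc (length W) ≡ N →
               let B = block U ++ block V ++ block W in m ≡ suc (length B) ⊎ m ≡ length B
  top-length U V W eq = subst (λ k → m ≡ suc k ⊎ m ≡ k) (sym (trans (length-blocks U V W) eq)) top
  reverse-sum : ∀ x y z → z + y + x ≡ x + y + z
  reverse-sum = solve-∀
  reversed-sum : suc (length Z) + suc (length Y) + suc (length X) ≡ N
  reversed-sum = trans (reverse-sum (suc (length X)) (suc (length Y)) (suc (length Z))) sum

iter-+ : ∀ j k π → iter (j + k) π ≡ iter k (iter j π)
iter-+ zero    k π = refl
iter-+ (suc j) k π = iter-+ j k (topdrop π)

heads-+ : ∀ j k π → heads (j + k) π ≡ heads j π ++ heads k (iter j π)
heads-+ zero    k π = refl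
heads-+ (suc j) k π = cong (first π ∷_) (heads-+ j k (topdrop π))

length-heads : ∀ k π → length (heads k π) ≡ k
length-heads zero    π = refl
length-heads (suc k) π = cong suc (length-heads k (topdrop π))

rotate-heads : ∀ j k π → iter j π ≡ π → iter (j + k) π ≡ π → rotate j (heads (j + k) π) ≡ heads (j + k) π
rotate-heads j k π πʲ≡π πʲ⁺ᵏ≡π = begin
  rotate j (heads (j + k) π)                            ≡⟨ cong (rotate j) (heads-+ j k π) ⟩
  rotate j (heads j π ++ heads k (iter j π))            ≡⟨ cong (λ ρ → rotate j (heads j π ++ heads k ρ)) πʲ≡π ⟩
  rotate j (heads j π ++ heads k π)                     ≡⟨ cong (λ i → rotate i (heads j π ++ heads k π)) (length-heads j π) ⟨
  rotate (length (heads j π)) (heads j π ++ heads k π)  ≡⟨ rotate-length-++ (heads j π) (heads k π) ⟩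
  heads k π ++ heads j π                                ≡⟨ cong (λ ρ → heads k π ++ heads j ρ) πᵏ≡π ⟨
  heads k π ++ heads j (iter k π)                       ≡⟨ heads-+ k j π ⟨
  heads (k + j) π                                       ≡⟨ cong (λ i → heads i π) (+-comm k j) ⟩
  heads (j + k) π                                       ∎
  where
  open ≡-Reasoning
  πᵏ≡π : iter k π ≡ π
  πᵏ≡π = trans (cong (iter k) (sym πʲ≡π)) (trans (sym (iter-+ j k π)) πʲ⁺ᵏ≡π)

Primitive : List ℕ → Set
Primitive w = ∀ j → 1 ≤ j → j < length w → rotate j w ≢ w

primitive-cycle⇒MinPeriod : ∀ {π w} → Path π w π → 1 ≤ length w → Primitive w → MinPeriod π (length w)
primitive-cycle⇒MinPeriod {π} {w} cycle 1≤s w-primitive = 1≤s , Path-iter cycle , not-period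
  where
  open ≡-Reasoning
  not-period : ∀ j → 1 ≤ j → j < length w → iter j π ≢ π
  not-period j 1≤j j<s πʲ≡π = w-primitive j 1≤j j<s (begin
    rotate j w                     ≡⟨ cong (rotate j) (Path-heads cycle) ⟨
    rotate j (heads (length w) π)  ≡⟨ cong (λ s → rotate j (heads s π)) s≡j+k ⟩
    rotate j (heads (j + k) π)     ≡⟨ rotate-heads j k π πʲ≡π (subst (λ s → iter s π ≡ π) s≡j+k (Path-iter cycle)) ⟩
    heads (j + k) π                ≡⟨ cong (λ s → heads s π) s≡j+k ⟨
    heads (length w) π             ≡⟨ Path-heads cycle ⟩
    w                              ∎)
    where
    k = length w ∸ j
    s≡j+k : length w ≡ j + k
    s≡j+k = sym (m+[n∸m]≡n (<⇒≤ j<s))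

primitive-cycle⇒TopdropNecklace : ∀ {π w} → Path π w π → 1 ≤ length w → Primitive w → IsTopdropNecklaceOf w π
primitive-cycle⇒TopdropNecklace {w = w} cycle 1≤s w-primitive =
  length w , primitive-cycle⇒MinPeriod cycle 1≤s w-primitive , 0 , trans (++-identityʳ _) (Path-heads cycle)

-- Rotating by 4 exchanges a and c, so a < c singles out one of the two readings of the necklace.
Canonical : (ℕ × ℕ × ℕ) × ℕ → Set
Canonical ((a , b , c) , m) = a < c × b < m

canonical-rotation : ∀ {t t′} k → Canonical t → Canonical t′ → rotate k (necklace t) ≡ necklace t′ →
                     (k ≡ 0 ⊎ 8 ≤ k) × t ≡ t′
canonical-rotation 0 _ _ refl = inj₁ refl , refl
canonical-rotation 1 (a<c , _) _ refl = ⊥-elim (<-irrefl refl a<c)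
canonical-rotation 2 (a<c , _) _ refl = ⊥-elim (<-irrefl refl a<c)
canonical-rotation 3 (_ , b<m) _ refl = ⊥-elim (<-irrefl refl b<m)
canonical-rotation 4 (a<c , _) (c<a , _) refl = ⊥-elim (<-asym a<c c<a)
canonical-rotation 5 (a<c , _) _ refl = ⊥-elim (<-irrefl refl a<c)
canonical-rotation 6 (a<c , _) _ refl = ⊥-elim (<-irrefl refl a<c)
canonical-rotation 7 (a<c , _) _ refl = ⊥-elim (<-irrefl refl a<c)
canonical-rotation 8 _ _ refl = inj₂ ≤-refl , refl
canonical-rotation (suc (suc (suc (suc (suc (suc (suc (suc (suc k))))))))) _ _ refl = inj₂ (m≤m+n 8 (suc k)) , refl

necklace-primitive : ∀ {t} → Canonical t → Primitive (necklace t)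
necklace-primitive can j 1≤j j<8 eq with canonical-rotation j can can eq
... | inj₁ refl , _ = <⇒≱ 1≤j z≤n
... | inj₂ 8≤j  , _ = <⇒≱ j<8 8≤j

necklace-≈ᶜ-injective : ∀ {t t′} → Canonical t → Canonical t′ → necklace t ≈ᶜ necklace t′ → t ≡ t′
necklace-≈ᶜ-injective can can′ (k , eq) = proj₂ (canonical-rotation k can can′ eq)

∈-delete : ∀ {v w : A} ys zs → v ≢ w → w ∈ ys ++ v ∷ zs → w ∈ ys ++ zs
∈-delete {v = v} ys zs v≢w w∈ with ∈-resp-↭ (shift v ys zs) w∈
... | here w≡v = ⊥-elim (v≢w (sym w≡v))
... | there w∈ys++zs = w∈ys++zs

unique-⊆⇒↭++ : ∀ {vs xs : List A} → Unique vs → All (_∈ xs) vs → ∃ λ ys → xs ↭ vs ++ ys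
unique-⊆⇒↭++ {xs = xs} [] [] = xs , ↭-refl
unique-⊆⇒↭++ {vs = v ∷ _} (v∉vs ∷ vs!) (v∈xs ∷ vs⊆xs) with ∈-∃++ v∈xs
... | ys , zs , refl with unique-⊆⇒↭++ vs! (All.zipWith (λ (v≢w , w∈) → ∈-delete ys zs v≢w w∈) (v∉vs , vs⊆xs))
... | rest , p = rest , ↭-trans (shift v ys zs) (↭-prep v p)

++-split : ∀ k {l} (xs : List A) → length xs ≡ k + l → ∃₂ λ ys zs → xs ≡ ys ++ zs × length ys ≡ k × length zs ≡ l
++-split zero    xs       ∣xs∣ = [] , xs , refl , refl , ∣xs∣
++-split (suc k) (x ∷ xs) ∣xs∣ with ++-split k xs (suc-injective ∣xs∣)
... | ys , zs , refl , ∣ys∣ , ∣zs∣ = x ∷ ys , zs , refl , cong suc ∣ys∣ , ∣zs∣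

pull : ∀ (xs : List A) {ys zs v} → ys ↭ v ∷ zs → xs ++ ys ↭ v ∷ xs ++ zs
pull xs {zs = zs} {v} p = ↭-trans (++⁺ˡ xs p) (shift v xs zs)

blocks↭ : ∀ X Y Z m → blocks X Y Z m ↭ suc (length X) ∷ suc (length Y) ∷ suc (length Z) ∷ m ∷ X ++ Y ++ Z
blocks↭ X Y Z m = ↭-prep (suc (length X)) (begin
  X ++ b ∷ Y ++ c ∷ Z ++ [ m ]  ↭⟨ shift b X _ ⟩
  b ∷ X ++ Y ++ c ∷ Z ++ [ m ]  ↭⟨ ↭-prep b (pull X (shift c Y _)) ⟩
  b ∷ c ∷ X ++ Y ++ Z ++ [ m ]  ↭⟨ ↭-prep b (↭-prep c (pull X (pull Y (↭-sym (∷↭∷ʳ m Z))))) ⟩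
  b ∷ c ∷ m ∷ X ++ Y ++ Z       ∎)
  where
  open PermutationReasoning
  b = suc (length Y)
  c = suc (length Z)

Composition₃ : ℕ → ℕ × ℕ × ℕ → Set
Composition₃ N (a , b , c) = 1 ≤ a × 1 ≤ b × 1 ≤ c × a + b + c ≡ N

Arranged : ℕ → ℕ × ℕ × ℕ → Set
Arranged N (a , b , c) = Composition₃ N (a , b , c) × a ≢ b × b ≢ c × a < c

Admissible : ℕ → (ℕ × ℕ × ℕ) × ℕ → Set
Admissible N (t , m) = Arranged N t × (m ≡ suc N ⊎ m ≡ N)

parts<sum : ∀ {N a b c} → Composition₃ N (a , b , c) → a < N × b < N × c < N
parts<sum {N} {a} {b} {c} (1≤a , 1≤b , 1≤c , sum) =
  <-≤-trans (m<m+n a 1≤b) a+b≤N , <-≤-trans (m<n+m b 1≤a) a+b≤N , <-≤-trans (m<n+m c (≤-trans 1≤a (m≤m+n a b))) (≤-reflexive sum)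
  where
  a+b≤N : a + b ≤ N
  a+b≤N = ≤-trans (m≤m+n (a + b) c) (≤-reflexive sum)

top-≥ : ∀ {N m} → m ≡ suc N ⊎ m ≡ N → N ≤ m
top-≥ (inj₁ refl) = n≤1+n _
top-≥ (inj₂ refl) = ≤-refl

top-≤ : ∀ {N m} → m ≡ suc N ⊎ m ≡ N → m ≤ suc N
top-≤ (inj₁ refl) = ≤-refl
top-≤ (inj₂ refl) = n≤1+n _

parts<top : ∀ {N a b c m} → Admissible N ((a , b , c) , m) → a < m × b < m × c < m
parts<top ((comp , _) , top) with parts<sum comp
... | a<N , b<N , c<N = <-≤-trans a<N N≤m , <-≤-trans b<N N≤m , <-≤-trans c<N N≤m
  where
  N≤m = top-≥ top

admissible-canonical : ∀ {N} t → Admissible N t → Canonical t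
admissible-canonical _ adm@((_ , _ , _ , a<c) , _) = a<c , proj₁ (proj₂ (parts<top adm))

∈-range : ∀ {v n} → 1 ≤ v → v ≤ n → v ∈ map suc (upTo n)
∈-range {suc v} (s≤s z≤n) v<n = ∈-map⁺ suc (∈-upTo⁺ v<n)

length-range : ∀ n → length (map suc (upTo n)) ≡ n
length-range n = trans (length-map suc (upTo n)) (length-upTo n)

letters-unique : ∀ {N a b c m} → Admissible N ((a , b , c) , m) → Unique (a ∷ b ∷ c ∷ m ∷ [])
letters-unique adm@((_ , a≢b , b≢c , a<c) , _) with parts<top adm
... | a<m , b<m , c<m =
  (a≢b ∷ <⇒≢ a<c ∷ <⇒≢ a<m ∷ []) ∷ (b≢c ∷ <⇒≢ b<m ∷ []) ∷ (<⇒≢ c<m ∷ []) ∷ [] ∷ []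

letters-in-range : ∀ {N a b c m} → Admissible N ((a , b , c) , m) → All (_∈ map suc (upTo (suc N))) (a ∷ b ∷ c ∷ m ∷ [])
letters-in-range adm@(((1≤a , 1≤b , 1≤c , _) , _) , top) with parts<top adm
... | a<m , b<m , c<m =
  ∈-range 1≤a (≤-trans (<⇒≤ a<m) m≤n) ∷ ∈-range 1≤b (≤-trans (<⇒≤ b<m) m≤n) ∷ ∈-range 1≤c (≤-trans (<⇒≤ c<m) m≤n) ∷
  ∈-range (≤-trans 1≤a (<⇒≤ a<m)) m≤n ∷ []
  where
  m≤n = top-≤ top

split-blocks : ∀ {a b c} (R : List ℕ) → 1 ≤ a → 1 ≤ b → 1 ≤ c → 3 + length R ≡ a + b + c →
               ∃ λ X → ∃ λ Y → ∃ λ Z → R ≡ X ++ Y ++ Z × suc (length X) ≡ a × suc (length Y) ≡ b × suc (length Z) ≡ c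
split-blocks R (s≤s {n = a} z≤n) (s≤s {n = b} z≤n) (s≤s {n = c} z≤n) ∣R∣
  with ++-split a R (+-cancelˡ-≡ 3 _ _ (trans ∣R∣ (suc-parts a b c)))
  where
  suc-parts : ∀ a b c → suc a + suc b + suc c ≡ 3 + (a + (b + c))
  suc-parts = solve-∀
... | X , YZ , refl , ∣X∣ , ∣YZ∣ with ++-split b YZ ∣YZ∣
... | Y , Z , refl , ∣Y∣ , ∣Z∣ = X , Y , Z , refl , cong suc ∣X∣ , cong suc ∣Y∣ , cong suc ∣Z∣

topdropValid-blocks : ∀ {n N m} X Y Z → suc (length X) + suc (length Y) + suc (length Z) ≡ N → m ≡ suc N ⊎ m ≡ N →
                      let t = (suc (length X) , suc (length Y) , suc (length Z)) , m in
                      Canonical t → IsPerm n (blocks X Y Z m) → TopdropValid n (necklace t)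
topdropValid-blocks X Y Z sum top can perm =
  blocks X Y Z _ , perm , primitive-cycle⇒TopdropNecklace (orbit X Y Z sum top) (s≤s z≤n) (necklace-primitive can)

topdropValid : ∀ {N} t → Admissible N t → TopdropValid (suc N) (necklace t)
topdropValid {N} ((a , b , c) , m) adm@(((1≤a , 1≤b , 1≤c , sum) , _) , top)
  with unique-⊆⇒↭++ (letters-unique adm) (letters-in-range adm)
... | R , range↭abcmR
  with split-blocks R 1≤a 1≤b 1≤c (trans (suc-injective (trans (sym (↭-length range↭abcmR)) (length-range (suc N)))) (sym sum))
... | X , Y , Z , refl , refl , refl , refl =
  topdropValid-blocks X Y Z sum top (admissible-canonical _ adm) (↭-trans (blocks↭ X Y Z m) (↭-sym range↭abcmR))

ofForm : ∀ {N} t → Admissible N t → OfForm (suc N) (necklace t)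
ofForm ((a , b , c) , m) ((comp@(1≤a , 1≤b , 1≤c , sum) , a≢b , b≢c , a<c) , top) with parts<sum comp
... | a<N , b<N , c<N =
  a , b , c , m , a≢b , b≢c , <⇒≢ a<c , 1≤a , <⇒≤pred a<N , 1≤b , <⇒≤pred b<N , 1≤c , <⇒≤pred c<N , sum , top , refl

disjoint-by : ∀ {P : A → Set} {xs ys} → All P xs → All (¬_ ∘ P) ys → Disjoint xs ys
disjoint-by pxs ¬pys (v∈xs , v∈ys) = All.lookup ¬pys v∈ys (All.lookup pxs v∈xs)

Unique-map-++ : ∀ {f : A → B} {g : A′ → B} {xs ys} → (∀ {x y} → f x ≡ f y → x ≡ y) → (∀ {x y} → g x ≡ g y → x ≡ y) →
                (∀ x y → f x ≢ g y) → Unique xs → Unique ys → Unique (map f xs ++ map g ys)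
Unique-map-++ {f = f} {g} f-inj g-inj f≢g xs! ys! = Unique.++⁺ (Unique.map⁺ f-inj xs!) (Unique.map⁺ g-inj ys!) disjoint
  where
  disjoint : Disjoint (map f _) (map g _)
  disjoint (v∈fxs , v∈gys) with ∈-map⁻ f v∈fxs | ∈-map⁻ g v∈gys
  ... | x , _ , refl | y , _ , fx≡gy = f≢g x y fx≡gy

Unique⇒AllPairs : ∀ {P : A → Set} {R : A → A → Set} {xs} → (∀ {x y} → P x → P y → R x y → x ≡ y) →
                  All P xs → Unique xs → AllPairs (λ x y → ¬ R x y) xs
Unique⇒AllPairs R⇒≡ []         []            = []
Unique⇒AllPairs R⇒≡ (px ∷ pxs) (x∉xs ∷ xs!) =
  All.zipWith (λ (py , x≢y) rxy → x≢y (R⇒≡ px py rxy)) (pxs , x∉xs) ∷ Unique⇒AllPairs R⇒≡ pxs xs!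

-- Partitions of M into parts ≤ 2, resp. ≤ 3, are listed by their multiplicities (p , q) of the
-- parts 2, 1, resp. (r , p , q) of the parts 3, 2, 1.
weight₂ : ℕ × ℕ → ℕ
weight₂ (p , q) = p * 2 + q

weight₃ : ℕ × ℕ × ℕ → ℕ
weight₃ (r , pq) = r * 3 + weight₂ pq

partitions≤2 : ℕ → List (ℕ × ℕ)
partitions≤2 0             = [ 0 , 0 ]
partitions≤2 1             = [ 0 , 1 ]
partitions≤2 (suc (suc M)) = (0 , 2 + M) ∷ map (map₁ suc) (partitions≤2 M)

partitions≤3 : ℕ → List (ℕ × ℕ × ℕ)
partitions≤3 0                   = map (0 ,_) (partitions≤2 0)
partitions≤3 1                   = map (0 ,_) (partitions≤2 1)
partitions≤3 2                   = map (0 ,_) (partitions≤2 2)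
partitions≤3 (suc (suc (suc M))) = map (0 ,_) (partitions≤2 (3 + M)) ++ map (map₁ suc) (partitions≤3 M)

partitions≤2-weight : ∀ M → All (λ t → weight₂ t ≡ M) (partitions≤2 M)
partitions≤2-weight 0             = refl ∷ []
partitions≤2-weight 1             = refl ∷ []
partitions≤2-weight (suc (suc M)) = refl ∷ All.map⁺ (All.map (cong (2 +_)) (partitions≤2-weight M))

partitions≤3-weight : ∀ M → All (λ t → weight₃ t ≡ M) (partitions≤3 M)
partitions≤3-weight 0 = refl ∷ []
partitions≤3-weight 1 = refl ∷ []
partitions≤3-weight 2 = refl ∷ refl ∷ []
partitions≤3-weight (suc (suc (suc M))) =
  All.++⁺ (All.map⁺ (partitions≤2-weight (3 + M))) (All.map⁺ (All.map (cong (3 +_)) (partitions≤3-weight M)))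

Unique-zero-suc : ∀ {xs : List A} {ys : List (ℕ × A)} → Unique xs → Unique ys → Unique (map (0 ,_) xs ++ map (map₁ suc) ys)
Unique-zero-suc = Unique-map-++ (cong proj₂) (λ { {_ , _} {_ , _} refl → refl }) (λ { _ (_ , _) () })

partitions≤2-unique : ∀ M → Unique (partitions≤2 M)
partitions≤2-unique 0             = [] ∷ []
partitions≤2-unique 1             = [] ∷ []
partitions≤2-unique (suc (suc M)) = Unique-zero-suc ([] ∷ []) (partitions≤2-unique M)

partitions≤3-unique : ∀ M → Unique (partitions≤3 M)
partitions≤3-unique 0 = [] ∷ []
partitions≤3-unique 1 = [] ∷ []
partitions≤3-unique 2 = ((λ ()) ∷ []) ∷ [] ∷ []
partitions≤3-unique (suc (suc (suc M))) = Unique-zero-suc (partitions≤2-unique (3 + M)) (partitions≤3-unique M)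

length-partitions≤2-+2 : ∀ M → length (partitions≤2 (2 + M)) ≡ suc (length (partitions≤2 M))
length-partitions≤2-+2 M = cong suc (length-map (map₁ suc) (partitions≤2 M))

length-partitions≤2-+3-+6 : ∀ M → length (partitions≤2 (3 + M)) + length (partitions≤2 (6 + M)) ≡ 6 + M
length-partitions≤2-+3-+6 0             = refl
length-partitions≤2-+3-+6 1             = refl
length-partitions≤2-+3-+6 (suc (suc M)) = begin
  length (partitions≤2 (5 + M)) + length (partitions≤2 (8 + M))
    ≡⟨ cong₂ _+_ (length-partitions≤2-+2 (3 + M)) (length-partitions≤2-+2 (6 + M)) ⟩
  suc (length (partitions≤2 (3 + M))) + suc (length (partitions≤2 (6 + M)))
    ≡⟨ cong suc (+-suc (length (partitions≤2 (3 + M))) _) ⟩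
  2 + (length (partitions≤2 (3 + M)) + length (partitions≤2 (6 + M)))
    ≡⟨ cong (2 +_) (length-partitions≤2-+3-+6 M) ⟩
  8 + M ∎
  where open ≡-Reasoning

length-partitions≤3-+3 : ∀ M → length (partitions≤3 (3 + M)) ≡ length (partitions≤2 (3 + M)) + length (partitions≤3 M)
length-partitions≤3-+3 M =
  trans (length-++ (map _ (partitions≤2 (3 + M))))
        (cong₂ _+_ (length-map _ (partitions≤2 (3 + M))) (length-map _ (partitions≤3 M)))

length-partitions≤3-+6 : ∀ M → length (partitions≤3 (6 + M)) ≡ (6 + M) + length (partitions≤3 M)
length-partitions≤3-+6 M = begin
  length (partitions≤3 (6 + M))
    ≡⟨ length-partitions≤3-+3 (3 + M) ⟩
  c₂ (6 + M) + length (partitions≤3 (3 + M))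
    ≡⟨ cong (c₂ (6 + M) +_) (length-partitions≤3-+3 M) ⟩
  c₂ (6 + M) + (c₂ (3 + M) + length (partitions≤3 M))
    ≡⟨ +-assoc (c₂ (6 + M)) _ _ ⟨
  (c₂ (6 + M) + c₂ (3 + M)) + length (partitions≤3 M)
    ≡⟨ cong (_+ length (partitions≤3 M)) (trans (+-comm (c₂ (6 + M)) _) (length-partitions≤2-+3-+6 M)) ⟩
  (6 + M) + length (partitions≤3 M) ∎
  where
  open ≡-Reasoning
  c₂ : ℕ → ℕ
  c₂ K = length (partitions≤2 K)

MeetsBound-+6 : ∀ N k → MeetsBound (suc N) k → MeetsBound (7 + N) (6 * N + k)
MeetsBound-+6 N k bound = begin
  (7 + N) * (7 + N) + constBy ((7 + N) % 6)  ≡⟨ cong (λ r → (7 + N) * (7 + N) + constBy r) period ⟩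
  (7 + N) * (7 + N) + C                      ≡⟨ square-step N C ⟩
  (suc N * suc N + C) + (12 * N + 48)        ≤⟨ +-monoˡ-≤ (12 * N + 48) bound ⟩
  (2 * k + 8 * suc N) + (12 * N + 48)        ≡⟨ linear-step N k ⟩
  2 * (6 * N + k) + 8 * (7 + N)              ∎
  where
  open ≤-Reasoning
  C = constBy (suc N % 6)
  period : (7 + N) % 6 ≡ suc N % 6
  period = trans (cong (_% 6) (+-comm 6 (suc N))) ([m+n]%n≡m%n (suc N) 6)
  square-step : ∀ N C → (7 + N) * (7 + N) + C ≡ (suc N * suc N + C) + (12 * N + 48)
  square-step = solve-∀
  linear-step : ∀ N k → (2 * k + 8 * suc N) + (12 * N + 48) ≡ 2 * (6 * N + k) + 8 * (7 + N)
  linear-step = solve-∀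

partitions≤3-bound : ∀ M → MeetsBound (7 + M) (6 * length (partitions≤3 M))
partitions≤3-bound 0 = ≤ᵇ⇒≤ _ _ tt
partitions≤3-bound 1 = ≤ᵇ⇒≤ _ _ tt
partitions≤3-bound 2 = ≤ᵇ⇒≤ _ _ tt
partitions≤3-bound 3 = ≤ᵇ⇒≤ _ _ tt
partitions≤3-bound 4 = ≤ᵇ⇒≤ _ _ tt
partitions≤3-bound 5 = ≤ᵇ⇒≤ _ _ tt
partitions≤3-bound (suc (suc (suc (suc (suc (suc M)))))) =
  subst (MeetsBound (13 + M)) (sym count) (MeetsBound-+6 (6 + M) _ (partitions≤3-bound M))
  where
  count : 6 * length (partitions≤3 (6 + M)) ≡ 6 * (6 + M) + 6 * length (partitions≤3 M)
  count = trans (cong (6 *_) (length-partitions≤3-+6 M)) (*-distribˡ-+ 6 (6 + M) _)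

staircase : ℕ × ℕ × ℕ → ℕ × ℕ × ℕ
staircase (r , p , q) = 1 + r , 2 + r + p , 3 + r + p + q

Increasing : ℕ × ℕ × ℕ → Set
Increasing (x , y , z) = x < y × y < z

IncreasingComposition : ℕ → ℕ × ℕ × ℕ → Set
IncreasingComposition N t = Composition₃ N t × Increasing t

staircase-increasing : ∀ t → IncreasingComposition (6 + weight₃ t) (staircase t)
staircase-increasing (r , p , q) =
  (s≤s z≤n , s≤s z≤n , s≤s z≤n , sum r p q) , s≤s (s≤s (m≤m+n r p)) , s≤s (s≤s (s≤s (m≤m+n (r + p) q)))
  where
  sum : ∀ r p q → (1 + r) + (2 + r + p) + (3 + r + p + q) ≡ 6 + (r * 3 + (p * 2 + q))
  sum = solve-∀

staircase-injective : ∀ {t t′} → staircase t ≡ staircase t′ → t ≡ t′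
staircase-injective {r , p , q} {r′ , p′ , q′} eq with cong proj₁ eq
... | refl with +-cancelˡ-≡ (2 + r) p p′ (cong (proj₁ ∘ proj₂) eq)
... | refl with +-cancelˡ-≡ (3 + r + p) q q′ (cong (proj₂ ∘ proj₂) eq)
... | refl = refl

swap₁₂ : ℕ × ℕ × ℕ → ℕ × ℕ × ℕ
swap₁₂ (x , y , z) = y , x , z

swap₂₃ : ℕ × ℕ × ℕ → ℕ × ℕ × ℕ
swap₂₃ (x , y , z) = x , z , y

-- For x < y < z these are the three (a , b , c) with {a , b , c} = {x , y , z} and a < c.
arrangements : List (ℕ × ℕ × ℕ) → List (ℕ × ℕ × ℕ)
arrangements T = T ++ map swap₁₂ T ++ map swap₂₃ T

arrangements-arranged : ∀ {N T} → All (IncreasingComposition N) T → All (Arranged N) (arrangements T)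
arrangements-arranged ics =
  All.++⁺ (All.map arranged ics) (All.++⁺ (All.map⁺ (All.map arranged₁₂ ics)) (All.map⁺ (All.map arranged₂₃ ics)))
  where
  arranged : ∀ {N t} → IncreasingComposition N t → Arranged N t
  arranged (comp , x<y , y<z) = comp , <⇒≢ x<y , <⇒≢ y<z , <-trans x<y y<z
  arranged₁₂ : ∀ {N t} → IncreasingComposition N t → Arranged N (swap₁₂ t)
  arranged₁₂ {t = x , y , z} ((1≤x , 1≤y , 1≤z , sum) , x<y , y<z) =
    (1≤y , 1≤x , 1≤z , trans (cong (_+ z) (+-comm y x)) sum) , (<⇒≢ x<y ∘ sym) , <⇒≢ (<-trans x<y y<z) , y<z
  arranged₂₃ : ∀ {N t} → IncreasingComposition N t → Arranged N (swap₂₃ t)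
  arranged₂₃ {t = x , y , z} ((1≤x , 1≤y , 1≤z , sum) , x<y , y<z) =
    (1≤x , 1≤z , 1≤y , trans (swap-sum x y z) sum) , <⇒≢ (<-trans x<y y<z) , (<⇒≢ y<z ∘ sym) , x<y
    where
    swap-sum : ∀ x y z → x + z + y ≡ x + y + z
    swap-sum = solve-∀

arrangements-unique : ∀ {T} → All Increasing T → Unique T → Unique (arrangements T)
arrangements-unique {T} inc T! =
  Unique.++⁺ T! (Unique.++⁺ (Unique.map⁺ swap₁₂-injective T!) (Unique.map⁺ swap₂₃-injective T!) swaps-disjoint)
    (disjoint-by inc (All.++⁺ (All.map⁺ (All.map (λ (x<y , _) (y<x , _) → <-asym x<y y<x) inc))
                              (All.map⁺ (All.map (λ (_ , y<z) (_ , z<y) → <-asym y<z z<y) inc))))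
  where
  swap₁₂-injective : ∀ {t t′} → swap₁₂ t ≡ swap₁₂ t′ → t ≡ t′
  swap₁₂-injective {_ , _ , _} {_ , _ , _} refl = refl
  swap₂₃-injective : ∀ {t t′} → swap₂₃ t ≡ swap₂₃ t′ → t ≡ t′
  swap₂₃-injective {_ , _ , _} {_ , _ , _} refl = refl
  swaps-disjoint : Disjoint (map swap₁₂ T) (map swap₂₃ T)
  swaps-disjoint = disjoint-by {P = Increasing ∘ swap₁₂} (All.map⁺ inc)
    (All.map⁺ (All.map (λ (x<y , y<z) (z<x , _) → <-asym (<-trans x<y y<z) z<x) inc))

candidates : ℕ → List ((ℕ × ℕ × ℕ) × ℕ)
candidates M = map (_, suc N) S ++ map (_, N) S
  where
  N = 6 + M
  S = arrangements (map staircase (partitions≤3 M))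

staircases-increasing : ∀ M → All (IncreasingComposition (6 + M)) (map staircase (partitions≤3 M))
staircases-increasing M =
  All.map⁺ (All.map (λ {t} w≡M → subst (λ K → IncreasingComposition (6 + K) (staircase t)) w≡M (staircase-increasing t))
                    (partitions≤3-weight M))

candidates-admissible : ∀ M → All (Admissible (6 + M)) (candidates M)
candidates-admissible M = All.++⁺ (All.map⁺ (All.map (_, inj₁ refl) arranged)) (All.map⁺ (All.map (_, inj₂ refl) arranged))
  where
  arranged = arrangements-arranged (staircases-increasing M)

candidates-unique : ∀ M → Unique (candidates M)
candidates-unique M = Unique-map-++ (cong proj₁) (cong proj₁) (λ _ _ eq → 1+n≢n (cong proj₂ eq)) S! S!
  where
  S! = arrangements-unique (All.map proj₂ (staircases-increasing M)) (Unique.map⁺ staircase-injective (partitions≤3-unique M))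

length-candidates : ∀ M → length (candidates M) ≡ 6 * length (partitions≤3 M)
length-candidates M = begin
  length (map (_, suc N) S ++ map (_, N) S)          ≡⟨ length-++ (map (_, suc N) S) ⟩
  length (map (_, suc N) S) + length (map (_, N) S)  ≡⟨ cong₂ _+_ (length-map _ S) (length-map _ S) ⟩
  length S + length S                                ≡⟨ cong₂ _+_ length-S length-S ⟩
  c + (c + c) + (c + (c + c))                        ≡⟨ six c ⟩
  6 * c                                              ∎
  where
  open ≡-Reasoning
  N = 6 + M
  T = map staircase (partitions≤3 M)
  S = arrangements T
  c = length (partitions≤3 M)
  length-T : length T ≡ c
  length-T = length-map staircase (partitions≤3 M)
  length-map-T : ∀ f → length (map f T) ≡ c
  length-map-T f = trans (length-map f T) length-T
  length-S : length S ≡ c + (c + c)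
  length-S = begin
    length (T ++ map swap₁₂ T ++ map swap₂₃ T)                  ≡⟨ length-++ T ⟩
    length T + length (map swap₁₂ T ++ map swap₂₃ T)            ≡⟨ cong (length T +_) (length-++ (map swap₁₂ T)) ⟩
    length T + (length (map swap₁₂ T) + length (map swap₂₃ T))  ≡⟨ cong₂ _+_ length-T (cong₂ _+_ (length-map-T swap₁₂) (length-map-T swap₂₃)) ⟩
    c + (c + c)                                                 ∎
  six : ∀ c → c + (c + c) + (c + (c + c)) ≡ 6 * c
  six = solve-∀

lemma4p13 : (n : ℕ) → 4 ≤ n →
    Σ (List (List ℕ)) λ L →
      All (λ w → OfForm n w × TopdropValid n w) L ×
      AllPairs (λ u v → ¬ (u ≈ᶜ v)) L ×
      MeetsBound n (length L)
lemma4p13 0 ()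
lemma4p13 1 (s≤s ())
lemma4p13 2 (s≤s (s≤s ()))
lemma4p13 3 (s≤s (s≤s (s≤s ())))
lemma4p13 4 _ = [] , [] , [] , ≤ᵇ⇒≤ _ _ tt
lemma4p13 5 _ = [] , [] , [] , ≤ᵇ⇒≤ _ _ tt
lemma4p13 6 _ = [] , [] , [] , ≤ᵇ⇒≤ _ _ tt
lemma4p13 (suc (suc (suc (suc (suc (suc (suc M))))))) _ =
  map necklace (candidates M) ,
  All.map⁺ (All.map (λ {t} adm → ofForm t adm , topdropValid t adm) admissible) ,
  AllPairs.map⁺ (Unique⇒AllPairs ≈ᶜ⇒≡ admissible (candidates-unique M)) ,
  subst (MeetsBound (7 + M)) (sym (trans (length-map necklace (candidates M)) (length-candidates M))) (partitions≤3-bound M)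
  where
  admissible = candidates-admissible M
  ≈ᶜ⇒≡ : ∀ {t t′} → Admissible (6 + M) t → Admissible (6 + M) t′ → necklace t ≈ᶜ necklace t′ → t ≡ t′
  ≈ᶜ⇒≡ {t} {t′} adm adm′ = necklace-≈ᶜ-injective (admissible-canonical t adm) (admissible-canonical t′ adm′)
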